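{- Let $\sigma\in\mathfrak{S}_n$. Then $\mathrm{zer}(\mathrm{HAN}\text{ -code}(\sigma))=\mathrm{rlmin}(\sigma)$.
   Context: $\mathfrak{S}_n$ is the set of permutations of $\{1,\dots,n\}$, written as words $\sigma=\sigma_1\cdots\sigma_n$. A value $\sigma_j$ is a right-to-left minimum if $\sigma_j<\sigma_k$ for all $k>j$; $\mathrm{rlmin}(\sigma)$ is their number. An excedance of $\sigma$ is an index $j$ with $\sigma_j>j$, and $\sigma_j$ is then an excedance top; $\mathrm{exc}(\sigma)$ is the number of excedances. Han's map $\Psi:\mathfrak{S}_{n-1}\times\{0,1,\dots,n-1\}\to\mathfrak{S}_n$ ($n\ge2$) is defined as follows. If $s=0$, $\Psi(\sigma,0)=\sigma_1\cdots\sigma_{n-1}n$. If $s\ge1$: define a bijection $\nu$ from the values $\{1,\dots,n-1\}$ to $\{1,\dots,n-1\}$ by letting $\nu$ assign $1,2,\dots,\mathrm{exc}(\sigma)$ to the excedance tops of $\sigma$ in decreasing order of value, and $\mathrm{exc}(\sigma)+1,\dots,n-1$ to the non-excedance tops of $\sigma$ in increasing order of value. Let $v=\nu^{ -1}(s)$. Let $a_1>a_2>\cdots>a_m$ ($m\ge0$) be the excedance tops of $\sigma$ that are $\ge v$, and set $a_0=n$. For $i=1,\dots,m$ replace the letter $a_i$ in $\sigma$ by $a_{i-1}$ (in the same position), and then insert the letter $a_m$ so that it occupies position $v$ (shifting later letters one place to the right); the resulting word is $\Psi(\sigma,s)$. (For example $\Psi(341625,2)=3614725$, $\Psi(341625,5)=4361725$,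 $\Psi(1,1)=21$.) By a theorem of Han, the map $E_n\to\mathfrak{S}_n$ sending $(e_1,\dots,e_n)$ (where necessarily $e_1=0$) to $\Psi(\cdots\Psi(\Psi(1,e_2),e_3)\cdots,e_n)$ is a bijection, where $E_n$ is the set of integer $n$-tuples with $0\le e_j\le j-1$; $\mathrm{HAN}\text{ -code}(\sigma)\in E_n$ is the preimage of $\sigma$ under this bijection. For an integer tuple, $\mathrm{zer}$ is the number of its entries equal to $0$. -}

module Defs where

open import Data.Nat using (ℕ; zero; suc; _∸_; _≤_; _<ᵇ_; _≡ᵇ_; _+_)
open import Data.Bool using (Bool; true; false; if_then_else_; not; _∨_)
open import Data.List using (List; []; _∷_; _++_; [_]; length; map; upTo; take; drop; foldl; reverse)
open import Data.List.Relation.Binary.Permutation.Propositional using (_↭_)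
open import Data.Vec using (Vec; lookup; toList)
open import Data.Fin using (Fin; toℕ)

-- Permutations are words over ℕ; 𝔖ₙ = words that are rearrangements of 1 … n.
oneTo : ℕ → List ℕ
oneTo n = map suc (upTo n)

IsPerm : ℕ → List ℕ → Set
IsPerm n σ = σ ↭ oneTo n

filt : (ℕ → Bool) → List ℕ → List ℕ
filt p [] = []
filt p (x ∷ xs) = if p x then x ∷ filt p xs else filt p xs

elem : ℕ → List ℕ → Bool
elem x [] = false
elem x (y ∷ ys) = (x ≡ᵇ y) ∨ elem x ys

allᵇ : (ℕ → Bool) → List ℕ → Bool
allᵇ p [] = true
allᵇ p (y ∷ ys) = if p y then allᵇ p ys else false

-- safe 1-indexed lookup (default 0 out of range)
nth1 : ℕ → List ℕ → ℕ
nth1 _ [] = 0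
nth1 zero (x ∷ xs) = 0
nth1 (suc zero) (x ∷ xs) = x
nth1 (suc (suc k)) (x ∷ xs) = nth1 (suc k) xs

headOr : ℕ → List ℕ → ℕ
headOr d [] = d
headOr d (x ∷ _) = x

rlmin : List ℕ → ℕ
rlmin [] = 0
rlmin (x ∷ xs) = (if allᵇ (x <ᵇ_) xs then 1 else 0) + rlmin xs

zer : List ℕ → ℕ
zer [] = 0
zer (zero ∷ xs) = suc (zer xs)
zer (suc _ ∷ xs) = zer xs

-- excedance tops: values σ_j with σ_j > j (positions 1-indexed)
excTopsFrom : ℕ → List ℕ → List ℕ
excTopsFrom j [] = []
excTopsFrom j (x ∷ xs) = if j <ᵇ x then x ∷ excTopsFrom (suc j) xs else excTopsFrom (suc j) xs

excTops : List ℕ → List ℕ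
excTops = excTopsFrom 1

excInc : List ℕ → List ℕ
excInc σ = filt (λ x → elem x (excTops σ)) (oneTo (length σ))

excDec : List ℕ → List ℕ
excDec σ = reverse (excInc σ)

nonExcInc : List ℕ → List ℕ
nonExcInc σ = filt (λ x → not (elem x (excTops σ))) (oneTo (length σ))

nuInv : List ℕ → ℕ → ℕ
nuInv σ s = nth1 s (excDec σ ++ nonExcInc σ)

-- insert letter x so that it occupies (1-indexed) position v
insertAt : ℕ → ℕ → List ℕ → List ℕ
insertAt v x l = take (v ∸ 1) l ++ x ∷ drop (v ∸ 1) l

-- Han's map Ψ : 𝔖_{n-1} × {0,…,n-1} → 𝔖_n, where n = length σ + 1.
-- With a₁ > … > a_m the excedance tops ≥ v and a₀ = n, the letter aᵢ is
-- replaced by aᵢ₋₁, i.e. by the smallest excedance top > aᵢ (or n if none);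
-- a_m is the smallest excedance top ≥ v (or n if m = 0).
Ψ : List ℕ → ℕ → List ℕ
Ψ σ zero = σ ++ [ suc (length σ) ]
Ψ σ (suc s) = insertAt v am (map repl σ)
  where
  n : ℕ
  n = suc (length σ)
  v : ℕ
  v = nuInv σ (suc s)
  ex : List ℕ
  ex = excInc σ
  am : ℕ
  am = headOr n (filt (λ y → v ≤ᵇ y) ex)
    where
    _≤ᵇ_ : ℕ → ℕ → Bool
    a ≤ᵇ b = a <ᵇ suc b
  repl : ℕ → ℕ
  repl x = if elem x ex ∧ (v <ᵇ suc x) then headOr n (filt (x <ᵇ_) ex) else x
    where
    _∧_ : Bool → Bool → Bool
    true ∧ b = b
    false ∧ _ = false

-- Han's bijection E_n → 𝔖_n : (e₁,…,eₙ) ↦ Ψ(⋯Ψ(Ψ(1,e₂),e₃)⋯,eₙ)  (e₁ = 0 is ignored)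
hanMap : List ℕ → List ℕ
hanMap [] = []
hanMap (_ ∷ es) = foldl Ψ [ 1 ] es

-- E_n : tuples (e₁,…,eₙ) with 0 ≤ e_j ≤ j-1; with 0-indexed Fin j this is e[j] ≤ j
InE : {n : ℕ} → Vec ℕ n → Set
InE {n} e = (j : Fin n) → lookup e j ≤ toℕ j

IsHanCode : (n : ℕ) → Vec ℕ n → List ℕ → Set
IsHanCode n e σ = InE e × (hanMap (toList e) ≡ σ)
  where
  open import Data.Product using (_×_)
  open import Relation.Binary.PropositionalEquality using (_≡_)

-- Han's map builds σ letter by letter, and every step keeps σ a permutation of 1 … length σ.
-- A step Ψ(σ, 0) appends the new maximum n, which is a new right-to-left minimum and leaves
-- the others alone. A step Ψ(σ, s) with s ≥ 1 changes only excedance tops, and these are never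
-- right-to-left minima, since a right-to-left minimum cannot exceed its position. Raising each
-- chain top aᵢ to aᵢ₋₁ preserves, for every letter, whether all letters to its right are larger,
-- and the inserted letter aₘ is not a right-to-left minimum and exceeds every right-to-left
-- minimum before it. So exactly the zeros of the code create right-to-left minima.

module Submission where

open import Defs
open import Data.Bool using (Bool; true; false; if_then_else_; _∧_; T)
open import Data.Bool.Properties using (¬-not)
open import Data.Empty using (⊥-elim)
open import Data.Fin using () renaming (zero to fzero)
open import Data.List using (List; []; _∷_; _++_; [_]; length; map; take; drop; foldl; upTo)
open import Data.List.Membership.Propositional using (_∈_; _∉_)
open import Data.List.Membership.Propositional.Properties
  using (∈-++⁺ˡ; ∈-++⁺ʳ; ∈-++⁻; ∈-map⁺; ∈-map⁻; ∈-upTo⁻; ∈-upTo⁺; ∈-∃++)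
open import Data.List.Properties
  using (length-++; length-map; length-upTo; length-take; take++drop≡id; ++-assoc; map-cong)
import Data.List.Relation.Unary.All as All
open import Data.List.Relation.Unary.All using ([]; _∷_)
open import Data.List.Relation.Unary.All.Properties using (¬Any⇒All¬)
import Data.List.Relation.Unary.AllPairs as AllPairs
import Data.List.Relation.Unary.AllPairs.Properties as AllPairsₚ
open import Data.List.Relation.Unary.AllPairs using (AllPairs; []; _∷_)
open import Data.List.Relation.Unary.Any using (here; there)
import Data.List.Relation.Unary.Any.Properties as Anyₚ
open import Data.List.Relation.Unary.Unique.Propositional using (Unique)
open import Data.List.Relation.Unary.Unique.Propositional.Properties using (Unique[x∷xs]⇒x∉xs)
import Data.List.Relation.Unary.Unique.Propositional.Properties as Uniqueₚ
open import Data.Nat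
open import Data.Nat.Properties
open import Data.Unit using (tt)
import Data.Product as Prod
open import Data.Product using (Σ; ∃-syntax; _×_; _,_; proj₁; proj₂)
import Data.Sum as Sum
open import Data.Sum using (_⊎_; inj₁; inj₂; [_,_]′)
open import Data.Vec using (Vec; toList; []; _∷_)
open import Function using (id; _∘_)
open import Relation.Binary.Definitions using (tri<; tri≈; tri>)
open import Relation.Nullary using (¬_; yes; no)
open import Relation.Binary.PropositionalEquality hiding ([_])
open import Data.List.Membership.DecPropositional _≟_ using (_∈?_)

true≢false : true ≢ false
true≢false ()

<ᵇ-sound : ∀ {x y} → (x <ᵇ y) ≡ true → x < y
<ᵇ-sound {x} {y} e = <ᵇ⇒< x y (subst T (sym e) tt)

<ᵇ-complete : ∀ {x y} → x < y → (x <ᵇ y) ≡ true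
<ᵇ-complete {x} {y} x<y with x <ᵇ y | <⇒<ᵇ x<y
... | true | _ = refl

<ᵇ≡false⇒≥ : ∀ {x y} → (x <ᵇ y) ≡ false → y ≤ x
<ᵇ≡false⇒≥ e = ≮⇒≥ (λ x<y → true≢false (trans (sym (<ᵇ-complete x<y)) e))

≥⇒<ᵇ≡false : ∀ {x y} → y ≤ x → (x <ᵇ y) ≡ false
≥⇒<ᵇ≡false y≤x = ¬-not (λ e → <⇒≱ (<ᵇ-sound e) y≤x)

≡ᵇ-sound : ∀ {x y} → (x ≡ᵇ y) ≡ true → x ≡ y
≡ᵇ-sound {x} {y} e = ≡ᵇ⇒≡ x y (subst T (sym e) tt)

elem-sound : ∀ {x} l → elem x l ≡ true → x ∈ l
elem-sound {x} (y ∷ l) e with x ≡ᵇ y in x≡ᵇy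
... | true = here (≡ᵇ-sound x≡ᵇy)
... | false = there (elem-sound l e)

elem-complete : ∀ {x l} → x ∈ l → elem x l ≡ true
elem-complete {x} {y ∷ l} (here refl) with x ≡ᵇ x | ≡⇒≡ᵇ x x refl
... | true | _ = refl
elem-complete {x} {y ∷ l} (there x∈l) with x ≡ᵇ y
... | true = refl
... | false = elem-complete x∈l

filt-sound : ∀ p l {x} → x ∈ filt p l → x ∈ l × p x ≡ true
filt-sound p (y ∷ l) x∈ with p y in py
filt-sound p (y ∷ l) (here refl) | true = here refl , py
filt-sound p (y ∷ l) (there x∈) | true = Prod.map₁ there (filt-sound p l x∈)
filt-sound p (y ∷ l) x∈ | false = Prod.map₁ there (filt-sound p l x∈)

filt-complete : ∀ p l {x} → x ∈ l → p x ≡ true → x ∈ filt p l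
filt-complete p (y ∷ l) (here refl) px rewrite px = here refl
filt-complete p (y ∷ l) (there x∈l) px with p y
... | true = there (filt-complete p l x∈l px)
... | false = filt-complete p l x∈l px

allᵇ-sound : ∀ {p} l → allᵇ p l ≡ true → ∀ {y} → y ∈ l → p y ≡ true
allᵇ-sound {p} (x ∷ l) e y∈ with p x in px
allᵇ-sound {p} (x ∷ l) e (here refl) | true = px
allᵇ-sound {p} (x ∷ l) e (there y∈) | true = allᵇ-sound l e y∈

allᵇ-complete : ∀ {p} l → (∀ {y} → y ∈ l → p y ≡ true) → allᵇ p l ≡ true
allᵇ-complete [] h = refl
allᵇ-complete {p} (x ∷ l) h rewrite h (here refl) = allᵇ-complete l (h ∘ there)

allᵇ-counterexample : ∀ {p} l → allᵇ p l ≡ false → ∃[ y ] y ∈ l × p y ≡ false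
allᵇ-counterexample {p} (x ∷ l) e with p x in px
... | true = let (y , y∈ , py) = allᵇ-counterexample l e in y , there y∈ , py
... | false = x , here refl , px

allᵇ-refute : ∀ {p} l {y} → y ∈ l → p y ≡ false → allᵇ p l ≡ false
allᵇ-refute l y∈ py = ¬-not (λ e → true≢false (trans (sym (allᵇ-sound l e y∈)) py))

allᵇ-cong : ∀ {p q} l → (∀ {y} → y ∈ l → p y ≡ q y) → allᵇ p l ≡ allᵇ q l
allᵇ-cong [] p≗q = refl
allᵇ-cong {p} {q} (x ∷ l) p≗q rewrite p≗q (here refl) with q x
... | true = allᵇ-cong l (p≗q ∘ there)
... | false = refl

-- Duplicate-free lists and the pigeonhole principle

private variable
  A : Set
  x : A
  xs : List A

Unique-∷ : x ∉ xs → Unique xs → Unique (x ∷ xs)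
Unique-∷ x∉xs u = ¬Any⇒All¬ _ x∉xs ∷ u

Unique-++⁻ˡ : ∀ (xs : List A) {ys} → Unique (xs ++ ys) → Unique xs
Unique-++⁻ˡ [] u = []
Unique-++⁻ˡ (x ∷ xs) u =
  Unique-∷ (λ x∈xs → Unique[x∷xs]⇒x∉xs u (∈-++⁺ˡ x∈xs)) (Unique-++⁻ˡ xs (AllPairs.tail u))

Unique-middle : ∀ (xs : List A) {x ys} → Unique (xs ++ x ∷ ys) → x ∉ xs × x ∉ ys
Unique-middle [] u = (λ ()) , Unique[x∷xs]⇒x∉xs u
Unique-middle (z ∷ xs) u with Unique-middle xs (AllPairs.tail u)
... | x∉xs , x∉ys = (λ { (here refl) → Unique[x∷xs]⇒x∉xs u (∈-++⁺ʳ xs (here refl))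
                       ; (there x∈xs) → x∉xs x∈xs }) , x∉ys

remove : ∀ {y : A} ys → y ∈ ys →
         Σ (List A) λ zs → suc (length zs) ≡ length ys × (∀ {z} → z ∈ ys → z ≢ y → z ∈ zs)
remove (y ∷ ys) (here refl) = ys , refl , λ { (here refl) z≢y → ⊥-elim (z≢y refl) ; (there z∈) _ → z∈ }
remove (w ∷ ys) (there y∈) with remove ys y∈
... | zs , len , keep =
  w ∷ zs , cong suc len , λ { (here refl) _ → here refl ; (there z∈) z≢y → there (keep z∈ z≢y) }

Unique-⊆⇒length≤ : ∀ {xs : List A} ys → Unique xs → (∀ {z} → z ∈ xs → z ∈ ys) → length xs ≤ length ys
Unique-⊆⇒length≤ {xs = []} ys u xs⊆ys = z≤n
Unique-⊆⇒length≤ {xs = x ∷ xs} ys u xs⊆ys with remove ys (xs⊆ys (here refl))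
... | zs , len , keep = subst (suc (length xs) ≤_) len (s≤s (Unique-⊆⇒length≤ zs (AllPairs.tail u)
        (λ z∈xs → keep (xs⊆ys (there z∈xs)) (λ { refl → Unique[x∷xs]⇒x∉xs u z∈xs }))))

headOr-least : ∀ d {L} → AllPairs _<_ L → ∀ {z} → z ∈ L → headOr d L ≤ z
headOr-least d (_ ∷ _) (here refl) = ≤-refl
headOr-least d (x<L ∷ _) (there z∈L) = <⇒≤ (All.lookup x<L z∈L)

headOr-cases : ∀ d L → headOr d L ≡ d ⊎ headOr d L ∈ L
headOr-cases d [] = inj₁ refl
headOr-cases d (x ∷ L) = inj₂ (here refl)

AllPairs-filt : ∀ {R : ℕ → ℕ → Set} p {L} → AllPairs R L → AllPairs R (filt p L)
AllPairs-filt p [] = []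
AllPairs-filt p {x ∷ L} (Rx ∷ R-L) with p x
... | true = All.tabulate (λ z∈ → All.lookup Rx (proj₁ (filt-sound p L z∈)))
             ∷ AllPairs-filt p R-L
... | false = AllPairs-filt p R-L

headOr-filt-cases : ∀ d p L →
  headOr d (filt p L) ≡ d ⊎ (headOr d (filt p L) ∈ L × p (headOr d (filt p L)) ≡ true)
headOr-filt-cases d p L = Sum.map₂ (filt-sound p L) (headOr-cases d (filt p L))

headOr-filt-least : ∀ d p {L} → AllPairs _<_ L → ∀ {z} → z ∈ L → p z ≡ true → headOr d (filt p L) ≤ z
headOr-filt-least d p {L} inc z∈L pz = headOr-least d (AllPairs-filt p inc) (filt-complete p L z∈L pz)

oneTo-increasing : ∀ m → AllPairs _<_ (oneTo m)
oneTo-increasing m = AllPairsₚ.map⁺ (AllPairsₚ.applyUpTo⁺₁ id m (λ i<j _ → s≤s i<j))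

length-oneTo : ∀ m → length (oneTo m) ≡ m
length-oneTo m = trans (length-map suc (upTo m)) (length-upTo m)

∈-oneTo⁻ : ∀ {m z} → z ∈ oneTo m → 1 ≤ z × z ≤ m
∈-oneTo⁻ z∈ with ∈-map⁻ suc z∈
... | _ , i∈ , refl = s≤s z≤n , ∈-upTo⁻ i∈

∈-oneTo⁺ : ∀ {m z} → 1 ≤ z → z ≤ m → z ∈ oneTo m
∈-oneTo⁺ {z = suc i} _ i<m = ∈-map⁺ suc (∈-upTo⁺ i<m)

containsBelow⇒≤ : ∀ {b} L → Unique L → (∀ {y} → 1 ≤ y → y < b → y ∈ L) → b ≤ suc (length L)
containsBelow⇒≤ {zero} L u below = z≤n
containsBelow⇒≤ {suc b} L u below = s≤s (begin
  b                     ≡⟨ length-oneTo b ⟨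
  length (oneTo b)      ≤⟨ Unique-⊆⇒length≤ L (AllPairs.map <⇒≢ (oneTo-increasing b))
                             (λ y∈ → let (1≤y , y≤b) = ∈-oneTo⁻ y∈ in below 1≤y (s≤s y≤b)) ⟩
  length L              ∎)
  where open ≤-Reasoning

-- Equivalent to IsPerm (length σ) σ, but in a form that Ψ visibly preserves.
IsPermutation : List ℕ → Set
IsPermutation σ = Unique σ × (∀ {x} → x ∈ σ → 1 ≤ x × x ≤ length σ)

IsPermutation-[1] : IsPermutation [ 1 ]
IsPermutation-[1] = [] ∷ [] , λ { (here refl) → ≤-refl , ≤-refl }

IsPermutation⇒∈ : ∀ {σ} → IsPermutation σ → ∀ {y} → 1 ≤ y → y ≤ length σ → y ∈ σ
IsPermutation⇒∈ {σ} (u , bounded) {y} 1≤y y≤m with y ∈? σ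
... | yes y∈σ = y∈σ
... | no y∉σ = ⊥-elim (1+n≰n (begin
  suc (length σ)            ≤⟨ Unique-⊆⇒length≤ (oneTo (length σ)) (Unique-∷ y∉σ u) y∷σ⊆oneTo ⟩
  length (oneTo (length σ)) ≡⟨ length-oneTo (length σ) ⟩
  length σ                  ∎))
  where
  open ≤-Reasoning
  y∷σ⊆oneTo : ∀ {z} → z ∈ y ∷ σ → z ∈ oneTo (length σ)
  y∷σ⊆oneTo (here refl) = ∈-oneTo⁺ 1≤y y≤m
  y∷σ⊆oneTo (there z∈σ) = let (1≤z , z≤m) = bounded z∈σ in ∈-oneTo⁺ 1≤z z≤m

-- All smaller letters must precede a right-to-left minimum.
rlMin≤position : ∀ pre {x} S → IsPermutation (pre ++ x ∷ S) → allᵇ (x <ᵇ_) S ≡ true →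
                 x ≤ suc (length pre)
rlMin≤position pre {x} S perm@(u , bounded) x<S = containsBelow⇒≤ pre (Unique-++⁻ˡ pre u) below
  where
  x≤m : x ≤ length (pre ++ x ∷ S)
  x≤m = proj₂ (bounded (∈-++⁺ʳ pre (here refl)))
  below : ∀ {y} → 1 ≤ y → y < x → y ∈ pre
  below {y} 1≤y y<x with ∈-++⁻ pre (IsPermutation⇒∈ perm 1≤y (<⇒≤ (<-≤-trans y<x x≤m)))
  ... | inj₁ y∈pre = y∈pre
  ... | inj₂ (here refl) = ⊥-elim (<-irrefl refl y<x)
  ... | inj₂ (there y∈S) = ⊥-elim (<-asym y<x (<ᵇ-sound (allᵇ-sound S x<S y∈S)))

-- Excedance tops

excTopsFrom-sound : ∀ j l {x} → x ∈ excTopsFrom j l → j < x × x ∈ l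
excTopsFrom-sound j (y ∷ l) x∈ with j <ᵇ y in j<y
excTopsFrom-sound j (y ∷ l) (here refl) | true = <ᵇ-sound j<y , here refl
excTopsFrom-sound j (y ∷ l) (there x∈) | true with excTopsFrom-sound (suc j) l x∈
... | j<x , x∈l = <⇒≤ j<x , there x∈l
excTopsFrom-sound j (y ∷ l) x∈ | false with excTopsFrom-sound (suc j) l x∈
... | j<x , x∈l = <⇒≤ j<x , there x∈l

∈-excTopsFrom⁻ : ∀ j pre {x} S → x ∉ pre → x ∉ S → x ∈ excTopsFrom j (pre ++ x ∷ S) →
                 j + length pre < x
∈-excTopsFrom⁻ j [] {x} S x∉pre x∉S x∈ with j <ᵇ x in j<x
... | true = subst (_< x) (sym (+-identityʳ j)) (<ᵇ-sound j<x)
... | false = ⊥-elim (x∉S (proj₂ (excTopsFrom-sound (suc j) S x∈)))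
∈-excTopsFrom⁻ j (y ∷ pre) {x} S x∉pre x∉S x∈ with j <ᵇ y
... | true with x∈
...   | here refl = ⊥-elim (x∉pre (here refl))
...   | there x∈′ = subst (_< x) (sym (+-suc j (length pre)))
                      (∈-excTopsFrom⁻ (suc j) pre S (x∉pre ∘ there) x∉S x∈′)
∈-excTopsFrom⁻ j (y ∷ pre) {x} S x∉pre x∉S x∈ | false =
  subst (_< x) (sym (+-suc j (length pre))) (∈-excTopsFrom⁻ (suc j) pre S (x∉pre ∘ there) x∉S x∈)

∈-excTopsFrom⁺ : ∀ j pre {x} S → j + length pre < x → x ∈ excTopsFrom j (pre ++ x ∷ S)
∈-excTopsFrom⁺ j [] {x} S j<x rewrite <ᵇ-complete (subst (_< x) (+-identityʳ j) j<x) = here refl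
∈-excTopsFrom⁺ j (y ∷ pre) {x} S j+<x with j <ᵇ y
... | true = there (∈-excTopsFrom⁺ (suc j) pre S (subst (_< x) (+-suc j (length pre)) j+<x))
... | false = ∈-excTopsFrom⁺ (suc j) pre S (subst (_< x) (+-suc j (length pre)) j+<x)

insertAfter : ℕ → A → List A → List A
insertAfter k a l = take k l ++ a ∷ drop k l

length-insertAfter : ∀ k (a : A) l → length (insertAfter k a l) ≡ suc (length l)
length-insertAfter zero a l = refl
length-insertAfter (suc k) a [] = refl
length-insertAfter (suc k) a (y ∷ l) = cong suc (length-insertAfter k a l)

∈-insertAfter⁻ : ∀ k (a : A) l {z} → z ∈ insertAfter k a l → z ≡ a ⊎ z ∈ l
∈-insertAfter⁻ zero a l (here refl) = inj₁ refl
∈-insertAfter⁻ zero a l (there z∈l) = inj₂ z∈l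
∈-insertAfter⁻ (suc k) a [] (here refl) = inj₁ refl
∈-insertAfter⁻ (suc k) a (y ∷ l) (here refl) = inj₂ (here refl)
∈-insertAfter⁻ (suc k) a (y ∷ l) (there z∈) = Sum.map₂ there (∈-insertAfter⁻ k a l z∈)

Unique-insertAfter : ∀ k {a : A} {l} → a ∉ l → Unique l → Unique (insertAfter k a l)
Unique-insertAfter zero a∉l u = Unique-∷ a∉l u
Unique-insertAfter (suc k) {l = []} a∉l u = [] ∷ []
Unique-insertAfter (suc k) {a} {y ∷ l} a∉y∷l u =
  Unique-∷ (λ y∈ → [ (λ { refl → a∉y∷l (here refl) }) , Unique[x∷xs]⇒x∉xs u ]′
                      (∈-insertAfter⁻ k a l y∈))
           (Unique-insertAfter k (a∉y∷l ∘ there) (AllPairs.tail u))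

∈-take-middle : ∀ k (pre : List A) {x} S → length pre < k → x ∈ take k (pre ++ x ∷ S)
∈-take-middle (suc k) [] S _ = here refl
∈-take-middle (suc k) (y ∷ pre) S (s≤s |pre|<k) = there (∈-take-middle k pre S |pre|<k)

Unique-map : ∀ {B : Set} (f : A → B) {l} → (∀ {x y} → x ∈ l → y ∈ l → f x ≡ f y → x ≡ y) →
             Unique l → Unique (map f l)
Unique-map f {[]} inj u = []
Unique-map f {x ∷ l} inj u =
  Unique-∷ (λ fx∈ → let (y , y∈l , fx≡fy) = ∈-map⁻ f fx∈ in
                   Unique[x∷xs]⇒x∉xs u (subst (_∈ l) (sym (inj (here refl) (there y∈l) fx≡fy)) y∈l))
           (Unique-map f (λ x∈ y∈ → inj (there x∈) (there y∈)) (AllPairs.tail u))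

-- Counting right-to-left minima

allᵇ-snoc : ∀ p l {N} → p N ≡ true → allᵇ p (l ++ [ N ]) ≡ allᵇ p l
allᵇ-snoc p [] pN rewrite pN = refl
allᵇ-snoc p (x ∷ l) pN with p x
... | true = allᵇ-snoc p l pN
... | false = refl

rlmin-snoc : ∀ l N → (∀ {x} → x ∈ l → x < N) → rlmin (l ++ [ N ]) ≡ suc (rlmin l)
rlmin-snoc [] N l<N = refl
rlmin-snoc (x ∷ l) N l<N
  rewrite allᵇ-snoc (x <ᵇ_) l {N} (<ᵇ-complete (l<N (here refl))) =
  trans (cong (_ +_) (rlmin-snoc l N (l<N ∘ there))) (+-suc _ (rlmin l))

PreservesRLMin : (ℕ → ℕ) → List ℕ → Set
PreservesRLMin f S = ∀ S₁ x S₂ → S ≡ S₁ ++ x ∷ S₂ → allᵇ (x <ᵇ_) S₂ ≡ allᵇ (λ y → f x <ᵇ f y) S₂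

PreservesRLMin-tail : ∀ {f x S} → PreservesRLMin f (x ∷ S) → PreservesRLMin f S
PreservesRLMin-tail {x = x} pres S₁ y S₂ refl = pres (x ∷ S₁) y S₂ refl

allᵇ-map : ∀ p (f : ℕ → ℕ) l → allᵇ p (map f l) ≡ allᵇ (λ y → p (f y)) l
allᵇ-map p f [] = refl
allᵇ-map p f (y ∷ l) with p (f y)
... | true = allᵇ-map p f l
... | false = refl

allᵇ-insertAfter : ∀ p k a l → allᵇ p (insertAfter k a l) ≡ p a ∧ allᵇ p l
allᵇ-insertAfter p zero a l with p a
... | true = refl
... | false = refl
allᵇ-insertAfter p (suc k) a [] with p a
... | true = refl
... | false = refl
allᵇ-insertAfter p (suc k) a (y ∷ l) with p y
... | true = allᵇ-insertAfter p k a l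
... | false with p a
...   | true = refl
...   | false = refl

rlmin-map : ∀ f S → PreservesRLMin f S → rlmin (map f S) ≡ rlmin S
rlmin-map f [] pres = refl
rlmin-map f (x ∷ S) pres rewrite allᵇ-map (f x <ᵇ_) f S | sym (pres [] x S refl) =
  cong (_ +_) (rlmin-map f S (PreservesRLMin-tail {f} pres))

rlmin-insertAfter-map :
  ∀ f a k S → PreservesRLMin f S →
  (∀ S₁ x S₂ → S ≡ S₁ ++ x ∷ S₂ → length S₁ < k → allᵇ (x <ᵇ_) S₂ ≡ true → f x < a) →
  allᵇ (λ y → a <ᵇ f y) (drop k S) ≡ false →
  rlmin (insertAfter k a (map f S)) ≡ rlmin S
rlmin-insertAfter-map f a zero S pres before a-not-min
  rewrite allᵇ-map (a <ᵇ_) f S | a-not-min = rlmin-map f S pres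
rlmin-insertAfter-map f a (suc k) (x ∷ S) pres before a-not-min
  rewrite allᵇ-insertAfter (f x <ᵇ_) k a (map f S) | allᵇ-map (f x <ᵇ_) f S | sym (pres [] x S refl) =
  cong₂ _+_ head-status
    (rlmin-insertAfter-map f a k S (PreservesRLMin-tail {f} pres)
      (λ { S₁ y S₂ refl |S₁|<k → before (x ∷ S₁) y S₂ refl (s≤s |S₁|<k) }) a-not-min)
  where
  head-status : (if (f x <ᵇ a) ∧ allᵇ (x <ᵇ_) S then 1 else 0) ≡ (if allᵇ (x <ᵇ_) S then 1 else 0)
  head-status with allᵇ (x <ᵇ_) S in x<S
  ... | true rewrite <ᵇ-complete (before [] x S refl (s≤s z≤n) x<S) = refl
  ... | false with f x <ᵇ a
  ...   | true = refl
  ...   | false = refl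

-- The letters moved by Ψ σ (s + 1)

-- With a₁ > ⋯ > aₘ the excedance tops ≥ v, the letter aᵢ becomes aᵢ₋₁, the next larger
-- excedance top (a₀ = n), and aₘ is inserted at position v.
nextExcTop : List ℕ → ℕ → ℕ
nextExcTop σ x = headOr (suc (length σ)) (filt (x <ᵇ_) (excInc σ))

lastChainTop : List ℕ → ℕ → ℕ
lastChainTop σ v = headOr (suc (length σ)) (filt (λ y → v <ᵇ suc y) (excInc σ))

shift : List ℕ → ℕ → ℕ → ℕ
shift σ v x = if elem x (excInc σ) ∧ (v <ᵇ suc x) then nextExcTop σ x else x

-- Ψ tests membership in the chain with a `where`-local conjunction that cannot be named, so
-- the test is read off Ψ's normal form by unification and then identified with shift's.
Ψ-suc-unfolded : ∀ σ s → Σ (ℕ → Bool) λ moved →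
  Ψ σ (suc s) ≡ insertAt (nuInv σ (suc s)) (lastChainTop σ (nuInv σ (suc s)))
                  (map (λ x → if moved x then nextExcTop σ x else x) σ)
Ψ-suc-unfolded σ s = _ , refl

Ψ-moved-spec : ∀ σ s x →
  proj₁ (Ψ-suc-unfolded σ s) x ≡ elem x (excInc σ) ∧ (nuInv σ (suc s) <ᵇ suc x)
Ψ-moved-spec σ s x with elem x (excInc σ)
... | true = refl
... | false = refl

Ψ-suc≡ : ∀ σ s → let v = nuInv σ (suc s) in
         Ψ σ (suc s) ≡ insertAfter (v ∸ 1) (lastChainTop σ v) (map (shift σ v) σ)
Ψ-suc≡ σ s = trans (proj₂ (Ψ-suc-unfolded σ s))
  (cong (insertAt v (lastChainTop σ v))
        (map-cong (λ x → cong (λ b → if b then nextExcTop σ x else x) (Ψ-moved-spec σ s x)) σ))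
  where
  v : ℕ
  v = nuInv σ (suc s)

pred-squeeze : ∀ {a v} → 2 ≤ a → v ≤ a → a ≤ suc (pred v) → a ≡ v
pred-squeeze {v = zero} (s≤s (s≤s _)) _ (s≤s ())
pred-squeeze {v = suc w} _ v≤a a≤v = ≤-antisym a≤v v≤a

n≰pred[n] : ∀ {n} → 1 ≤ n → ¬ n ≤ pred n
n≰pred[n] {suc n} _ = 1+n≰n

module Ψ-step {σ : List ℕ} {v : ℕ}
  (σ-perm : IsPermutation σ) (1≤m : 1 ≤ length σ) (v≤m : v ≤ length σ) where

  private
    m n k a : ℕ
    m = length σ
    n = suc m
    k = v ∸ 1
    a = lastChainTop σ v
    f : ℕ → ℕ
    f = shift σ v
    ex : List ℕ
    ex = excInc σ

  InChain : ℕ → Set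
  InChain x = x ∈ ex × v ≤ x

  ∈σ⇒bounded : ∀ {x} → x ∈ σ → 1 ≤ x × x ≤ m
  ∈σ⇒bounded = proj₂ σ-perm

  ∈ex⇒excTop : ∀ {x} → x ∈ ex → x ∈ excTops σ
  ∈ex⇒excTop x∈ = elem-sound _ (proj₂ (filt-sound _ (oneTo m) x∈))

  ∈ex⇒≤m : ∀ {x} → x ∈ ex → x ≤ m
  ∈ex⇒≤m x∈ = proj₂ (∈-oneTo⁻ (proj₁ (filt-sound _ (oneTo m) x∈)))

  ex-increasing : AllPairs _<_ ex
  ex-increasing = AllPairs-filt _ (oneTo-increasing m)

  ∉-suffix : ∀ {pre x S} → σ ≡ pre ++ x ∷ S → x ∉ S
  ∉-suffix {pre} σ≡ = proj₂ (Unique-middle pre (subst Unique σ≡ (proj₁ σ-perm)))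

  excTop⇒position< : ∀ {pre x S} → σ ≡ pre ++ x ∷ S → x ∈ ex → suc (length pre) < x
  excTop⇒position< {pre} {x} {S} refl x∈ex =
    let x∉pre , x∉S = Unique-middle pre (proj₁ σ-perm) in
    ∈-excTopsFrom⁻ 1 pre S x∉pre x∉S (∈ex⇒excTop x∈ex)

  position<⇒excTop : ∀ {pre x S} → σ ≡ pre ++ x ∷ S → suc (length pre) < x → x ∈ ex
  position<⇒excTop {pre} {x} {S} refl p<x =
    filt-complete _ (oneTo m) (∈-oneTo⁺ (proj₁ (∈σ⇒bounded x∈σ)) (proj₂ (∈σ⇒bounded x∈σ)))
      (elem-complete (∈-excTopsFrom⁺ 1 pre S p<x))
    where
    x∈σ : x ∈ σ
    x∈σ = ∈-++⁺ʳ pre (here refl)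

  shift-cases : ∀ x → (InChain x × f x ≡ nextExcTop σ x) ⊎ (¬ InChain x × f x ≡ x)
  shift-cases x with elem x ex in x∈ex? | v <ᵇ suc x in v≤x?
  ... | true | true = inj₁ ((elem-sound ex x∈ex? , s≤s⁻¹ (<ᵇ-sound v≤x?)) , refl)
  ... | true | false =
    inj₂ ((λ (_ , v≤x) → true≢false (trans (sym (<ᵇ-complete (s≤s v≤x))) v≤x?)) , refl)
  ... | false | _ = inj₂ ((λ (x∈ex , _) → true≢false (trans (sym (elem-complete x∈ex)) x∈ex?)) , refl)

  inChain? : ∀ x → InChain x ⊎ ¬ InChain x
  inChain? x = Sum.map proj₁ proj₁ (shift-cases x)

  shift-inChain : ∀ {x} → InChain x → f x ≡ nextExcTop σ x
  shift-inChain {x} c = [ proj₂ , (λ (¬c , _) → ⊥-elim (¬c c)) ]′ (shift-cases x)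

  shift-notInChain : ∀ {x} → ¬ InChain x → f x ≡ x
  shift-notInChain {x} ¬c = [ (λ (c , _) → ⊥-elim (¬c c)) , proj₂ ]′ (shift-cases x)

  shift-inChain-cases : ∀ {x} → InChain x → f x ≡ n ⊎ (f x ∈ ex × x < f x)
  shift-inChain-cases {x} c rewrite shift-inChain c =
    Sum.map₂ (Prod.map₂ <ᵇ-sound) (headOr-filt-cases n (x <ᵇ_) ex)

  shift-inChain-< : ∀ {x} → InChain x → x < f x
  shift-inChain-< c with shift-inChain-cases c
  ... | inj₁ fx≡n = subst (_ <_) (sym fx≡n) (s≤s (∈ex⇒≤m (proj₁ c)))
  ... | inj₂ (_ , x<fx) = x<fx

  ≤-shift : ∀ x → x ≤ f x
  ≤-shift x with inChain? x
  ... | inj₁ c = <⇒≤ (shift-inChain-< c)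
  ... | inj₂ ¬c = ≤-reflexive (sym (shift-notInChain ¬c))

  shift-stays-inChain : ∀ {x} → InChain x → f x ≡ n ⊎ InChain (f x)
  shift-stays-inChain {x} c = Sum.map₂ (λ (fx∈ex , x<fx) → fx∈ex , ≤-trans (proj₂ c) (<⇒≤ x<fx))
                                             (shift-inChain-cases c)

  shift-≤n : ∀ {x} → x ≤ m → f x ≤ n
  shift-≤n {x} x≤m with inChain? x
  ... | inj₂ ¬c = subst (_≤ n) (sym (shift-notInChain ¬c)) (m≤n⇒m≤1+n x≤m)
  ... | inj₁ c with shift-inChain-cases c
  ...   | inj₁ fx≡n = ≤-reflexive fx≡n
  ...   | inj₂ (fx∈ex , _) = m≤n⇒m≤1+n (∈ex⇒≤m fx∈ex)

  shift-≤-larger : ∀ {x y} → InChain y → InChain x → y < x → f y ≤ x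
  shift-≤-larger {x} cy cx y<x rewrite shift-inChain cy =
    headOr-filt-least n _ ex-increasing (proj₁ cx) (<ᵇ-complete y<x)

  lastChainTop-cases : a ≡ n ⊎ InChain a
  lastChainTop-cases = Sum.map₂ (λ (a∈ex , v≤a) → a∈ex , s≤s⁻¹ (<ᵇ-sound v≤a))
                                      (headOr-filt-cases n (λ y → v <ᵇ suc y) ex)

  lastChainTop-least : ∀ {y} → InChain y → a ≤ y
  lastChainTop-least (y∈ex , v≤y) = headOr-filt-least n _ ex-increasing y∈ex (<ᵇ-complete (s≤s v≤y))

  v≤lastChainTop : v ≤ a
  v≤lastChainTop with lastChainTop-cases
  ... | inj₁ a≡n = subst (v ≤_) (sym a≡n) (m≤n⇒m≤1+n v≤m)
  ... | inj₂ ca = proj₂ ca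

  lastChainTop≤n : a ≤ n
  lastChainTop≤n with lastChainTop-cases
  ... | inj₁ a≡n = ≤-reflexive a≡n
  ... | inj₂ ca = m≤n⇒m≤1+n (∈ex⇒≤m (proj₁ ca))

  2≤lastChainTop : 2 ≤ a
  2≤lastChainTop with lastChainTop-cases
  ... | inj₁ a≡n = subst (2 ≤_) (sym a≡n) (s≤s 1≤m)
  ... | inj₂ ca = proj₁ (excTopsFrom-sound 1 σ (∈ex⇒excTop (proj₁ ca)))

  excTop-not-rlMin : ∀ {pre x S} → σ ≡ pre ++ x ∷ S → x ∈ ex → allᵇ (x <ᵇ_) S ≡ false
  excTop-not-rlMin {pre} {x} {S} σ≡ x∈ex = ¬-not λ x<S →
    <⇒≱ (excTop⇒position< σ≡ x∈ex) (rlMin≤position pre S (subst IsPermutation σ≡ σ-perm) x<S)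

  larger-left-of-inChain⇒inChain : ∀ {S₁ x S₂ y} → σ ≡ S₁ ++ x ∷ S₂ → y ∈ S₂ → InChain y → y < x →
                                   InChain x
  larger-left-of-inChain⇒inChain {S₁} {x} {S₂} {y} σ≡ y∈S₂ (y∈ex , v≤y) y<x with ∈-∃++ y∈S₂
  ... | T₁ , T₂ , refl = position<⇒excTop σ≡ p<x , ≤-trans v≤y (<⇒≤ y<x)
    where
    open ≤-Reasoning
    σ≡′ : σ ≡ (S₁ ++ x ∷ T₁) ++ y ∷ T₂
    σ≡′ = trans σ≡ (sym (++-assoc S₁ (x ∷ T₁) (y ∷ T₂)))
    p<x : suc (length S₁) < x
    p<x = begin-strict
      suc (length S₁)                ≤⟨ s≤s (m≤m+n (length S₁) (length T₁)) ⟩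
      suc (length S₁ + length T₁)    ≡⟨ +-suc (length S₁) (length T₁) ⟨
      length S₁ + length (x ∷ T₁)    ≡⟨ length-++ S₁ ⟨
      length (S₁ ++ x ∷ T₁)          <⟨ n<1+n _ ⟩
      suc (length (S₁ ++ x ∷ T₁))    <⟨ excTop⇒position< σ≡′ y∈ex ⟩
      y                              <⟨ y<x ⟩
      x                              ∎

  shift-<-inChain : ∀ {x y} → InChain x → y < x → f y < f x
  shift-<-inChain {x} {y} cx y<x with inChain? y
  ... | inj₁ cy = ≤-<-trans (shift-≤-larger cy cx y<x) (shift-inChain-< cx)
  ... | inj₂ ¬cy = subst (_< f x) (sym (shift-notInChain ¬cy)) (<-trans y<x (shift-inChain-< cx))

  -- A chain letter is a right-to-left minimum neither before nor after; any other letter x is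
  -- fixed, and no chain letter to the right of x is smaller than x.
  shift-preservesRLMin : PreservesRLMin f σ
  shift-preservesRLMin S₁ x S₂ σ≡ with inChain? x
  ... | inj₁ cx =
    let y , y∈S₂ , x≮ᵇy = allᵇ-counterexample S₂ (excTop-not-rlMin σ≡ (proj₁ cx))
        y<x = ≤∧≢⇒< (<ᵇ≡false⇒≥ x≮ᵇy) (λ y≡x → ∉-suffix σ≡ (subst (_∈ S₂) y≡x y∈S₂))
    in trans (excTop-not-rlMin σ≡ (proj₁ cx))
             (sym (allᵇ-refute S₂ y∈S₂ (≥⇒<ᵇ≡false (<⇒≤ (shift-<-inChain cx y<x)))))
  ... | inj₂ ¬cx rewrite shift-notInChain ¬cx = allᵇ-cong S₂ same-comparison
    where
    same-comparison : ∀ {y} → y ∈ S₂ → (x <ᵇ y) ≡ (x <ᵇ f y)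
    same-comparison {y} y∈S₂ with inChain? y
    ... | inj₂ ¬cy = cong (x <ᵇ_) (sym (shift-notInChain ¬cy))
    ... | inj₁ cy = trans (<ᵇ-complete x<y) (sym (<ᵇ-complete (<-trans x<y (shift-inChain-< cy))))
      where
      x<y : x < y
      x<y = ≤∧≢⇒< (≮⇒≥ (λ y<x → ¬cx (larger-left-of-inChain⇒inChain σ≡ y∈S₂ cy y<x)))
                  (λ { refl → ∉-suffix σ≡ y∈S₂ })

  rlMin-before-insertion : ∀ S₁ x S₂ → σ ≡ S₁ ++ x ∷ S₂ → length S₁ < k →
                           allᵇ (x <ᵇ_) S₂ ≡ true → f x < a
  rlMin-before-insertion S₁ x S₂ σ≡ |S₁|<k x<S₂ with inChain? x
  ... | inj₁ cx = ⊥-elim (true≢false (trans (sym x<S₂) (excTop-not-rlMin σ≡ (proj₁ cx))))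
  ... | inj₂ ¬cx rewrite shift-notInChain ¬cx = begin-strict
    x                ≤⟨ rlMin≤position S₁ S₂ (subst IsPermutation σ≡ σ-perm) x<S₂ ⟩
    suc (length S₁)  <⟨ pred-cancel-< {m = suc (length S₁)} |S₁|<k ⟩
    v                ≤⟨ v≤lastChainTop ⟩
    a                ∎
    where open ≤-Reasoning

  below-lastChainTop-in-prefix : allᵇ (λ y → a <ᵇ f y) (drop k σ) ≡ true →
                                 ∀ {y} → 1 ≤ y → y < a → y ∈ take k σ
  below-lastChainTop-in-prefix a<rest {y} 1≤y y<a
    with ∈-++⁻ (take k σ) (subst (y ∈_) (sym (take++drop≡id k σ))
                  (IsPermutation⇒∈ σ-perm 1≤y (s≤s⁻¹ (<-≤-trans y<a lastChainTop≤n))))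
  ... | inj₁ y∈prefix = y∈prefix
  ... | inj₂ y∈rest with inChain? y
  ...   | inj₁ cy = ⊥-elim (<⇒≱ y<a (lastChainTop-least cy))
  ...   | inj₂ ¬cy = ⊥-elim (<-asym y<a (subst (a <_) (shift-notInChain ¬cy)
                                          (<ᵇ-sound (allᵇ-sound (drop k σ) a<rest y∈rest))))

  lastChainTop-in-prefix : a ≡ v → a ∈ take k σ
  lastChainTop-in-prefix a≡v with lastChainTop-cases
  ... | inj₁ a≡n = ⊥-elim (1+n≰n (subst (_≤ m) (trans (sym a≡v) a≡n) v≤m))
  ... | inj₂ (a∈ex , _) with ∈-∃++ (proj₂ (excTopsFrom-sound 1 σ (∈ex⇒excTop a∈ex)))
  ...   | pre , S , σ≡ = subst (λ l → a ∈ take k l) (sym σ≡)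
            (∈-take-middle k pre S
              (<⇒≤pred (subst (suc (length pre) <_) a≡v (excTop⇒position< σ≡ a∈ex))))

  -- Otherwise 1 … a would all precede position v ≤ a.
  lastChainTop-not-rlMin : allᵇ (λ y → a <ᵇ f y) (drop k σ) ≡ false
  lastChainTop-not-rlMin = ¬-not λ a<rest →
    let below = below-lastChainTop-in-prefix a<rest
        a≡v = pred-squeeze 2≤lastChainTop v≤lastChainTop (prefix-bound below)
        upTo-a : ∀ {y} → 1 ≤ y → y < suc a → y ∈ take k σ
        upTo-a 1≤y y<1+a = [ below 1≤y , (λ { refl → lastChainTop-in-prefix a≡v }) ]′
                             (m≤n⇒m<n∨m≡n (s≤s⁻¹ y<1+a))
    in n≰pred[n] (≤-trans (s≤s z≤n) 2≤lastChainTop)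
         (subst (λ w → a ≤ pred w) (sym a≡v) (s≤s⁻¹ (prefix-bound upTo-a)))
    where
    prefix-bound : ∀ {b} → (∀ {y} → 1 ≤ y → y < b → y ∈ take k σ) → b ≤ suc k
    prefix-bound below = begin
      _                         ≤⟨ containsBelow⇒≤ (take k σ) (Uniqueₚ.take⁺ k (proj₁ σ-perm)) below ⟩
      suc (length (take k σ))   ≡⟨ cong suc (length-take k σ) ⟩
      suc (k ⊓ m)               ≤⟨ s≤s (m⊓n≤m k m) ⟩
      suc k                     ∎
      where open ≤-Reasoning

  shift-inChain-avoids-nonChain : ∀ {x y} → InChain x → ¬ InChain y → y ∈ σ → f x ≢ y
  shift-inChain-avoids-nonChain cx ¬cy y∈σ fx≡y with shift-stays-inChain cx
  ... | inj₁ fx≡n = 1+n≰n (subst (_≤ m) (trans (sym fx≡y) fx≡n) (proj₂ (∈σ⇒bounded y∈σ)))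
  ... | inj₂ cfx = ¬cy (subst InChain fx≡y cfx)

  shift-injective : ∀ {x y} → x ∈ σ → y ∈ σ → f x ≡ f y → x ≡ y
  shift-injective {x} {y} x∈σ y∈σ fx≡fy with inChain? x | inChain? y
  ... | inj₂ ¬cx | inj₂ ¬cy = trans (sym (shift-notInChain ¬cx)) (trans fx≡fy (shift-notInChain ¬cy))
  ... | inj₁ cx | inj₂ ¬cy =
    ⊥-elim (shift-inChain-avoids-nonChain cx ¬cy y∈σ (trans fx≡fy (shift-notInChain ¬cy)))
  ... | inj₂ ¬cx | inj₁ cy =
    ⊥-elim (shift-inChain-avoids-nonChain cy ¬cx x∈σ (trans (sym fx≡fy) (shift-notInChain ¬cx)))
  ... | inj₁ cx | inj₁ cy with <-cmp x y
  ...   | tri< x<y _ _ =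
    ⊥-elim (<⇒≱ (shift-inChain-< cy) (subst (_≤ y) fx≡fy (shift-≤-larger cx cy x<y)))
  ...   | tri≈ _ x≡y _ = x≡y
  ...   | tri> _ _ y<x =
    ⊥-elim (<⇒≱ (shift-inChain-< cx) (subst (_≤ x) (sym fx≡fy) (shift-≤-larger cy cx y<x)))

  lastChainTop∉shifted : a ∉ map f σ
  lastChainTop∉shifted a∈ with ∈-map⁻ f a∈
  ... | y , y∈σ , a≡fy with inChain? y
  ...   | inj₁ cy = <⇒≱ (shift-inChain-< cy) (subst (_≤ y) a≡fy (lastChainTop-least cy))
  ...   | inj₂ ¬cy with trans a≡fy (shift-notInChain ¬cy) | lastChainTop-cases
  ...     | a≡y | inj₁ a≡n = 1+n≰n (subst (_≤ m) (trans (sym a≡y) a≡n) (proj₂ (∈σ⇒bounded y∈σ)))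
  ...     | a≡y | inj₂ ca = ¬cy (subst InChain a≡y ca)

  IsPermutation-shifted : IsPermutation (insertAfter k a (map f σ))
  IsPermutation-shifted =
    Unique-insertAfter k lastChainTop∉shifted (Unique-map f shift-injective (proj₁ σ-perm)) , bounded
    where
    length≡n : length (insertAfter k a (map f σ)) ≡ n
    length≡n = trans (length-insertAfter k a (map f σ)) (cong suc (length-map f σ))
    bounded : ∀ {z} → z ∈ insertAfter k a (map f σ) → 1 ≤ z × z ≤ length (insertAfter k a (map f σ))
    bounded z∈ rewrite length≡n with ∈-insertAfter⁻ k a (map f σ) z∈
    ... | inj₁ refl = ≤-trans (s≤s z≤n) 2≤lastChainTop , lastChainTop≤n
    ... | inj₂ z∈shifted with ∈-map⁻ f z∈shifted
    ...   | y , y∈σ , refl =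
      ≤-trans (proj₁ (∈σ⇒bounded y∈σ)) (≤-shift y) , shift-≤n (proj₂ (∈σ⇒bounded y∈σ))

  rlmin-shifted : rlmin (insertAfter k a (map f σ)) ≡ rlmin σ
  rlmin-shifted =
    rlmin-insertAfter-map f a k σ shift-preservesRLMin rlMin-before-insertion lastChainTop-not-rlMin

nth1-bound : ∀ {m} i l → (∀ {z} → z ∈ l → z ≤ m) → nth1 i l ≤ m
nth1-bound i [] l≤m = z≤n
nth1-bound zero (x ∷ l) l≤m = z≤n
nth1-bound (suc zero) (x ∷ l) l≤m = l≤m (here refl)
nth1-bound (suc (suc i)) (x ∷ l) l≤m = nth1-bound (suc i) l (l≤m ∘ there)

-- nth1 returns 0 out of range, so this needs no bound on s: the theorem never uses eⱼ ≤ j - 1.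
nuInv≤length : ∀ σ s → nuInv σ s ≤ length σ
nuInv≤length σ s = nth1-bound s (excDec σ ++ nonExcInc σ) bounded
  where
  filt-oneTo-bound : ∀ p {z} → z ∈ filt p (oneTo (length σ)) → z ≤ length σ
  filt-oneTo-bound p z∈ = proj₂ (∈-oneTo⁻ (proj₁ (filt-sound p (oneTo (length σ)) z∈)))
  bounded : ∀ {z} → z ∈ excDec σ ++ nonExcInc σ → z ≤ length σ
  bounded z∈ with ∈-++⁻ (excDec σ) z∈
  ... | inj₁ z∈excDec = filt-oneTo-bound _ (Anyₚ.reverse⁻ z∈excDec)
  ... | inj₂ z∈nonExc = filt-oneTo-bound _ z∈nonExc

length-Ψ : ∀ σ e → length (Ψ σ e) ≡ suc (length σ)
length-Ψ σ zero = trans (length-++ σ) (+-comm (length σ) 1)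
length-Ψ σ (suc s) rewrite Ψ-suc≡ σ s =
  trans (length-insertAfter (v ∸ 1) (lastChainTop σ v) (map (shift σ v) σ))
        (cong suc (length-map (shift σ v) σ))
  where
  v : ℕ
  v = nuInv σ (suc s)

IsPermutation-Ψ : ∀ {σ} e → IsPermutation σ → 1 ≤ length σ → IsPermutation (Ψ σ e)
IsPermutation-Ψ {σ} zero (u , bounded) _ =
  Uniqueₚ.++⁺ u ([] ∷ []) (λ { (n∈σ , here refl) → 1+n≰n (proj₂ (bounded n∈σ)) }) , bounded′
  where
  bounded′ : ∀ {z} → z ∈ Ψ σ 0 → 1 ≤ z × z ≤ length (Ψ σ 0)
  bounded′ z∈ rewrite length-Ψ σ 0 with ∈-++⁻ σ z∈
  ... | inj₁ z∈σ = Prod.map₂ m≤n⇒m≤1+n (bounded z∈σ)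
  ... | inj₂ (here refl) = s≤s z≤n , ≤-refl
IsPermutation-Ψ {σ} (suc s) σ-perm 1≤m rewrite Ψ-suc≡ σ s =
  Ψ-step.IsPermutation-shifted σ-perm 1≤m (nuInv≤length σ (suc s))

rlmin-Ψ-zero : ∀ {σ} → IsPermutation σ → rlmin (Ψ σ 0) ≡ suc (rlmin σ)
rlmin-Ψ-zero {σ} (_ , bounded) = rlmin-snoc σ (suc (length σ)) (s≤s ∘ proj₂ ∘ bounded)

rlmin-Ψ-suc : ∀ {σ} s → IsPermutation σ → 1 ≤ length σ → rlmin (Ψ σ (suc s)) ≡ rlmin σ
rlmin-Ψ-suc {σ} s σ-perm 1≤m rewrite Ψ-suc≡ σ s =
  Ψ-step.rlmin-shifted σ-perm 1≤m (nuInv≤length σ (suc s))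

rlmin-foldl-Ψ : ∀ es σ → IsPermutation σ → 1 ≤ length σ → rlmin (foldl Ψ σ es) ≡ zer es + rlmin σ
rlmin-foldl-Ψ [] σ _ _ = refl
rlmin-foldl-Ψ (e ∷ es) σ σ-perm 1≤m = begin
  rlmin (foldl Ψ (Ψ σ e) es) ≡⟨ rlmin-foldl-Ψ es (Ψ σ e) (IsPermutation-Ψ e σ-perm 1≤m)
                                  (subst (1 ≤_) (sym (length-Ψ σ e)) (s≤s z≤n)) ⟩
  zer es + rlmin (Ψ σ e)     ≡⟨ step e ⟩
  zer (e ∷ es) + rlmin σ     ∎
  where
  open ≡-Reasoning
  step : ∀ e → zer es + rlmin (Ψ σ e) ≡ zer (e ∷ es) + rlmin σ
  step zero = trans (cong (zer es +_) (rlmin-Ψ-zero σ-perm)) (+-suc (zer es) (rlmin σ))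
  step (suc s) = cong (zer es +_) (rlmin-Ψ-suc s σ-perm 1≤m)

mainTheorem10 : (n : ℕ) (σ : List ℕ) (e : Vec ℕ n) →
    IsPerm n σ → IsHanCode n e σ → zer (toList e) ≡ rlmin σ
mainTheorem10 zero σ [] _ (_ , refl) = refl
mainTheorem10 (suc n) σ (e₁ ∷ es) _ (e∈E , refl) with e∈E fzero
... | z≤n = begin
  suc (zer (toList es))                ≡⟨ +-comm 1 (zer (toList es)) ⟩
  zer (toList es) + rlmin [ 1 ]        ≡⟨ rlmin-foldl-Ψ (toList es) [ 1 ] IsPermutation-[1] (s≤s z≤n) ⟨
  rlmin (foldl Ψ [ 1 ] (toList es))    ∎
  where open ≡-Reasoning
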